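{- For each type $\tau$ there exists a closed term $\mathrm{N}_\tau$ of type $\tau\to\mathsf{N}$ in the language of $\mathcal{T}$ such that for all pure closed terms $A$ and $B$ of type $\tau$, $\mathcal{T}\vdash\mathrm{N}_\tau\,A=\mathrm{N}_\tau\,B$ if and only if $\mathcal{T}\vdash A=B$.
   Context: G\"odel's theory $\mathcal{T}$: types are built from the ground type $\mathsf{N}$ by $\to$; terms are simply-typed lambda terms extended by the constants $0_\mathsf{N}$ of type $\mathsf{N}$, $\mathrm{S}_+$ of type $\mathsf{N}\to\mathsf{N}$, and, for each type $\tau$, $\mathrm{R}_\tau$ of type $\tau\to(\tau\to\mathsf{N}\to\tau)\to\mathsf{N}\to\tau$. Formulas are equations between terms of the same type; axioms are $\mathrm{R}_\tau\,A\,B\,0_\mathsf{N}=A$ and $\mathrm{R}_\tau\,A\,B\,(\mathrm{S}_+\,C)=B\,(\mathrm{R}_\tau\,A\,B\,C)\,C$ for all terms $A,B,C$ of types $\tau$, $\tau\to\mathsf{N}\to\tau$, $\mathsf{N}$; the rules of inference are $\beta\eta$-conversion and substitution of equals. $\mathcal{T}\vdash A=B$ means the equation is provable. A term is pure if it contains none of the constants $0_\mathsf{N},\mathrm{S}_+,\mathrm{R}_\tau$. -}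

module Defs where

open import Data.List using (List; []; _∷_)

infixr 7 _⇒_
data Ty : Set where
  N   : Ty
  _⇒_ : Ty → Ty → Ty

Ctx : Set
Ctx = List Ty

infix 4 _∋_
data _∋_ : Ctx → Ty → Set where
  here  : ∀ {Γ σ} → (σ ∷ Γ) ∋ σ
  there : ∀ {Γ σ τ} → Γ ∋ σ → (τ ∷ Γ) ∋ σ

data Tm (Γ : Ctx) : Ty → Set where
  var  : ∀ {σ} → Γ ∋ σ → Tm Γ σ
  lam  : ∀ {σ τ} → Tm (σ ∷ Γ) τ → Tm Γ (σ ⇒ τ)
  app  : ∀ {σ τ} → Tm Γ (σ ⇒ τ) → Tm Γ σ → Tm Γ τ
  zer  : Tm Γ N
  suc  : Tm Γ (N ⇒ N)
  rec  : (τ : Ty) → Tm Γ (τ ⇒ (τ ⇒ N ⇒ τ) ⇒ N ⇒ τ)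

Closed : Ty → Set
Closed = Tm []

Ren : Ctx → Ctx → Set
Ren Γ Δ = ∀ {σ} → Γ ∋ σ → Δ ∋ σ

extR : ∀ {Γ Δ τ} → Ren Γ Δ → Ren (τ ∷ Γ) (τ ∷ Δ)
extR ρ here      = here
extR ρ (there x) = there (ρ x)

ren : ∀ {Γ Δ σ} → Ren Γ Δ → Tm Γ σ → Tm Δ σ
ren ρ (var x)   = var (ρ x)
ren ρ (lam t)   = lam (ren (extR ρ) t)
ren ρ (app t u) = app (ren ρ t) (ren ρ u)
ren ρ zer       = zer
ren ρ suc       = suc
ren ρ (rec τ)   = rec τ

wk : ∀ {Γ σ τ} → Tm Γ σ → Tm (τ ∷ Γ) σ
wk = ren there

Sub : Ctx → Ctx → Set
Sub Γ Δ = ∀ {σ} → Γ ∋ σ → Tm Δ σ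

extS : ∀ {Γ Δ τ} → Sub Γ Δ → Sub (τ ∷ Γ) (τ ∷ Δ)
extS s here      = var here
extS s (there x) = wk (s x)

sub : ∀ {Γ Δ σ} → Sub Γ Δ → Tm Γ σ → Tm Δ σ
sub s (var x)   = s x
sub s (lam t)   = lam (sub (extS s) t)
sub s (app t u) = app (sub s t) (sub s u)
sub s zer       = zer
sub s suc       = suc
sub s (rec τ)   = rec τ

single : ∀ {Γ σ} → Tm Γ σ → Sub (σ ∷ Γ) Γ
single u here      = u
single u (there x) = var x

_[_] : ∀ {Γ σ τ} → Tm (σ ∷ Γ) τ → Tm Γ σ → Tm Γ τ
t [ u ] = sub (single u) t

infix 3 _⊢_≐_
data _⊢_≐_ (Γ : Ctx) : ∀ {σ} → Tm Γ σ → Tm Γ σ → Set where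
  ≐-refl  : ∀ {σ} {t : Tm Γ σ} → Γ ⊢ t ≐ t
  ≐-sym   : ∀ {σ} {t u : Tm Γ σ} → Γ ⊢ t ≐ u → Γ ⊢ u ≐ t
  ≐-trans : ∀ {σ} {t u v : Tm Γ σ} → Γ ⊢ t ≐ u → Γ ⊢ u ≐ v → Γ ⊢ t ≐ v
  ≐-app   : ∀ {σ τ} {t t' : Tm Γ (σ ⇒ τ)} {u u' : Tm Γ σ} →
            Γ ⊢ t ≐ t' → Γ ⊢ u ≐ u' → Γ ⊢ app t u ≐ app t' u'
  ≐-lam   : ∀ {σ τ} {t t' : Tm (σ ∷ Γ) τ} →
            (σ ∷ Γ) ⊢ t ≐ t' → Γ ⊢ lam t ≐ lam t'
  ≐-β     : ∀ {σ τ} (t : Tm (σ ∷ Γ) τ) (u : Tm Γ σ) →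
            Γ ⊢ app (lam t) u ≐ t [ u ]
  ≐-η     : ∀ {σ τ} (t : Tm Γ (σ ⇒ τ)) →
            Γ ⊢ lam (app (wk t) (var here)) ≐ t
  ≐-R0    : ∀ {τ} (A : Tm Γ τ) (B : Tm Γ (τ ⇒ N ⇒ τ)) →
            Γ ⊢ app (app (app (rec τ) A) B) zer ≐ A
  ≐-RS    : ∀ {τ} (A : Tm Γ τ) (B : Tm Γ (τ ⇒ N ⇒ τ)) (C : Tm Γ N) →
            Γ ⊢ app (app (app (rec τ) A) B) (app suc C)
              ≐ app (app B (app (app (app (rec τ) A) B) C)) C

infix 3 T⊢_≐_
T⊢_≐_ : ∀ {σ} → Closed σ → Closed σ → Set
T⊢ A ≐ B = [] ⊢ A ≐ B

data Pure {Γ : Ctx} : ∀ {σ} → Tm Γ σ → Set where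
  var : ∀ {σ} (x : Γ ∋ σ) → Pure (var x)
  lam : ∀ {σ τ} {t : Tm (σ ∷ Γ) τ} → Pure t → Pure (lam t)
  app : ∀ {σ τ} {t : Tm Γ (σ ⇒ τ)} {u : Tm Γ σ} → Pure t → Pure u → Pure (app t u)

-- Nτ is the reification map of normalisation by evaluation, programmed in T. Normal forms
-- with named variables are coded by Cantor pairing; a variable is reflected as the function
-- that extends its code by the codes of its arguments, and a function is reified by applying it
-- to a reflected variable with a fresh name. In the full set-theoretic model, which validates
-- every provable equation, Nτ A therefore evaluates to the code of the βη-normal form of a pure
-- term A. Codes determine normal forms, and pure terms are provably equal to their normal forms
-- (by Kripke reducibility), so equal codes force provably equal terms.

module Submission where

open import Defs
open import Data.Empty using (⊥-elim)
open import Data.List using ([]; _∷_)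
open import Data.Maybe using (Maybe; just; nothing)
import Data.Maybe as Maybe
open import Data.Maybe.Properties using (just-injective)
open import Data.Nat using (ℕ; zero; suc; _+_; _≤_; _<_; z≤n; s≤s; _≟_)
open import Data.Nat.Properties
open import Data.Product using (Σ; _,_; _×_)
open import Function.Base using (_∘_)
open import Function.Bundles using (_⇔_; mk⇔)
open import Relation.Binary.Definitions using (tri<; tri≈; tri>)
open import Relation.Binary.PropositionalEquality hiding ([_])
open import Relation.Nullary using (yes; no)

-- Renaming and substitution

_≗ʳ_ : ∀ {Γ Δ} → Ren Γ Δ → Ren Γ Δ → Set
ρ ≗ʳ ρ' = ∀ {σ} (x : _ ∋ σ) → ρ x ≡ ρ' x

_≗ˢ_ : ∀ {Γ Δ} → Sub Γ Δ → Sub Γ Δ → Set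
s ≗ˢ s' = ∀ {σ} (x : _ ∋ σ) → s x ≡ s' x

extR-cong : ∀ {Γ Δ τ} {ρ ρ' : Ren Γ Δ} → ρ ≗ʳ ρ' → extR {τ = τ} ρ ≗ʳ extR ρ'
extR-cong e here      = refl
extR-cong e (there x) = cong there (e x)

ren-cong : ∀ {Γ Δ σ} {ρ ρ' : Ren Γ Δ} → ρ ≗ʳ ρ' → (t : Tm Γ σ) → ren ρ t ≡ ren ρ' t
ren-cong e (var x)   = cong var (e x)
ren-cong e (lam t)   = cong lam (ren-cong (extR-cong e) t)
ren-cong e (app t u) = cong₂ app (ren-cong e t) (ren-cong e u)
ren-cong e zer       = refl
ren-cong e suc       = refl
ren-cong e (rec τ)   = refl

ren-∘ : ∀ {Γ Δ Θ σ} (ρ : Ren Γ Δ) (ρ' : Ren Δ Θ) (t : Tm Γ σ) →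
        ren ρ' (ren ρ t) ≡ ren (λ x → ρ' (ρ x)) t
ren-∘ ρ ρ' (var x)   = refl
ren-∘ ρ ρ' (lam t)   = cong lam (trans (ren-∘ (extR ρ) (extR ρ') t)
                         (ren-cong (λ { here → refl ; (there x) → refl }) t))
ren-∘ ρ ρ' (app t u) = cong₂ app (ren-∘ ρ ρ' t) (ren-∘ ρ ρ' u)
ren-∘ ρ ρ' zer       = refl
ren-∘ ρ ρ' suc       = refl
ren-∘ ρ ρ' (rec τ)   = refl

ren-id : ∀ {Γ σ} (t : Tm Γ σ) → ren (λ x → x) t ≡ t
ren-id (var x)   = refl
ren-id (lam t)   = cong lam (trans (ren-cong (λ { here → refl ; (there x) → refl }) t) (ren-id t))
ren-id (app t u) = cong₂ app (ren-id t) (ren-id u)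
ren-id zer       = refl
ren-id suc       = refl
ren-id (rec τ)   = refl

extS-cong : ∀ {Γ Δ τ} {s s' : Sub Γ Δ} → s ≗ˢ s' → extS {τ = τ} s ≗ˢ extS s'
extS-cong e here      = refl
extS-cong e (there x) = cong wk (e x)

sub-cong : ∀ {Γ Δ σ} {s s' : Sub Γ Δ} → s ≗ˢ s' → (t : Tm Γ σ) → sub s t ≡ sub s' t
sub-cong e (var x)   = e x
sub-cong e (lam t)   = cong lam (sub-cong (extS-cong e) t)
sub-cong e (app t u) = cong₂ app (sub-cong e t) (sub-cong e u)
sub-cong e zer       = refl
sub-cong e suc       = refl
sub-cong e (rec τ)   = refl

sub-ren : ∀ {Γ Δ Θ σ} (ρ : Ren Γ Δ) (s : Sub Δ Θ) (t : Tm Γ σ) →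
          sub s (ren ρ t) ≡ sub (λ x → s (ρ x)) t
sub-ren ρ s (var x)   = refl
sub-ren ρ s (lam t)   = cong lam (trans (sub-ren (extR ρ) (extS s) t)
                          (sub-cong (λ { here → refl ; (there x) → refl }) t))
sub-ren ρ s (app t u) = cong₂ app (sub-ren ρ s t) (sub-ren ρ s u)
sub-ren ρ s zer       = refl
sub-ren ρ s suc       = refl
sub-ren ρ s (rec τ)   = refl

ren-sub : ∀ {Γ Δ Θ σ} (s : Sub Γ Δ) (ρ : Ren Δ Θ) (t : Tm Γ σ) →
          ren ρ (sub s t) ≡ sub (λ x → ren ρ (s x)) t
ren-sub s ρ (var x)   = refl
ren-sub s ρ (lam t)   = cong lam (trans (ren-sub (extS s) (extR ρ) t) (sub-cong ext-wk t))
  where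
  ext-wk : (λ x → ren (extR ρ) (extS s x)) ≗ˢ extS (λ x → ren ρ (s x))
  ext-wk here      = refl
  ext-wk (there x) = trans (ren-∘ there (extR ρ) (s x)) (sym (ren-∘ ρ there (s x)))
ren-sub s ρ (app t u) = cong₂ app (ren-sub s ρ t) (ren-sub s ρ u)
ren-sub s ρ zer       = refl
ren-sub s ρ suc       = refl
ren-sub s ρ (rec τ)   = refl

sub-∘ : ∀ {Γ Δ Θ σ} (s : Sub Γ Δ) (s' : Sub Δ Θ) (t : Tm Γ σ) →
        sub s' (sub s t) ≡ sub (λ x → sub s' (s x)) t
sub-∘ s s' (var x)   = refl
sub-∘ s s' (lam t)   = cong lam (trans (sub-∘ (extS s) (extS s') t) (sub-cong ext-wk t))
  where
  ext-wk : (λ x → sub (extS s') (extS s x)) ≗ˢ extS (λ x → sub s' (s x))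
  ext-wk here      = refl
  ext-wk (there x) = trans (sub-ren there (extS s') (s x)) (sym (ren-sub s' there (s x)))
sub-∘ s s' (app t u) = cong₂ app (sub-∘ s s' t) (sub-∘ s s' u)
sub-∘ s s' zer       = refl
sub-∘ s s' suc       = refl
sub-∘ s s' (rec τ)   = refl

sub-var : ∀ {Γ Δ σ} (ρ : Ren Γ Δ) (t : Tm Γ σ) → sub (λ x → var (ρ x)) t ≡ ren ρ t
sub-var ρ (var x)   = refl
sub-var ρ (lam t)   = cong lam (trans (sub-cong (λ { here → refl ; (there x) → refl }) t)
                                      (sub-var (extR ρ) t))
sub-var ρ (app t u) = cong₂ app (sub-var ρ t) (sub-var ρ u)
sub-var ρ zer       = refl
sub-var ρ suc       = refl
sub-var ρ (rec τ)   = refl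

sub-id : ∀ {Γ σ} (t : Tm Γ σ) → sub var t ≡ t
sub-id t = trans (sub-var (λ x → x) t) (ren-id t)

ren-[] : ∀ {Γ Δ σ τ} (ρ : Ren Γ Δ) (t : Tm (σ ∷ Γ) τ) (u : Tm Γ σ) →
         ren ρ (t [ u ]) ≡ ren (extR ρ) t [ ren ρ u ]
ren-[] ρ t u = begin
  ren ρ (t [ u ])                              ≡⟨ ren-sub (single u) ρ t ⟩
  sub (λ x → ren ρ (single u x)) t             ≡⟨ sub-cong (λ { here → refl ; (there x) → refl }) t ⟩
  sub (λ x → single (ren ρ u) (extR ρ x)) t    ≡⟨ sub-ren (extR ρ) (single (ren ρ u)) t ⟨
  ren (extR ρ) t [ ren ρ u ]                   ∎
  where open ≡-Reasoning

≐-ren : ∀ {Γ Δ σ} (ρ : Ren Γ Δ) {t u : Tm Γ σ} → Γ ⊢ t ≐ u → Δ ⊢ ren ρ t ≐ ren ρ u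
≐-ren ρ ≐-refl        = ≐-refl
≐-ren ρ (≐-sym d)     = ≐-sym (≐-ren ρ d)
≐-ren ρ (≐-trans d e) = ≐-trans (≐-ren ρ d) (≐-ren ρ e)
≐-ren ρ (≐-app d e)   = ≐-app (≐-ren ρ d) (≐-ren ρ e)
≐-ren ρ (≐-lam d)     = ≐-lam (≐-ren (extR ρ) d)
≐-ren ρ (≐-β t u)     = subst (_ ⊢ app (lam (ren (extR ρ) t)) (ren ρ u) ≐_)
                              (sym (ren-[] ρ t u)) (≐-β _ _)
≐-ren ρ (≐-η t)       = subst (λ z → _ ⊢ lam (app z (var here)) ≐ ren ρ t)
                              (trans (ren-∘ ρ there t) (sym (ren-∘ there (extR ρ) t))) (≐-η (ren ρ t))
≐-ren ρ (≐-R0 A B)    = ≐-R0 _ _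
≐-ren ρ (≐-RS A B C)  = ≐-RS _ _ _

-- Normalisation of pure terms

mutual
  data Ne (Γ : Ctx) : Ty → Set where
    nvar : ∀ {σ} → Γ ∋ σ → Ne Γ σ
    napp : ∀ {σ τ} → Ne Γ (σ ⇒ τ) → Nf Γ σ → Ne Γ τ

  data Nf (Γ : Ctx) : Ty → Set where
    nlam : ∀ {σ τ} → Nf (σ ∷ Γ) τ → Nf Γ (σ ⇒ τ)
    nne  : Ne Γ N → Nf Γ N

mutual
  embNe : ∀ {Γ σ} → Ne Γ σ → Tm Γ σ
  embNe (nvar x)   = var x
  embNe (napp e v) = app (embNe e) (embNf v)

  embNf : ∀ {Γ σ} → Nf Γ σ → Tm Γ σ
  embNf (nlam v) = lam (embNf v)
  embNf (nne e)  = embNe e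

mutual
  renNe : ∀ {Γ Δ σ} → Ren Γ Δ → Ne Γ σ → Ne Δ σ
  renNe ρ (nvar x)   = nvar (ρ x)
  renNe ρ (napp e v) = napp (renNe ρ e) (renNf ρ v)

  renNf : ∀ {Γ Δ σ} → Ren Γ Δ → Nf Γ σ → Nf Δ σ
  renNf ρ (nlam v) = nlam (renNf (extR ρ) v)
  renNf ρ (nne e)  = nne (renNe ρ e)

mutual
  embNe-ren : ∀ {Γ Δ σ} (ρ : Ren Γ Δ) (e : Ne Γ σ) → embNe (renNe ρ e) ≡ ren ρ (embNe e)
  embNe-ren ρ (nvar x)   = refl
  embNe-ren ρ (napp e v) = cong₂ app (embNe-ren ρ e) (embNf-ren ρ v)

  embNf-ren : ∀ {Γ Δ σ} (ρ : Ren Γ Δ) (v : Nf Γ σ) → embNf (renNf ρ v) ≡ ren ρ (embNf v)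
  embNf-ren ρ (nlam v) = cong lam (embNf-ren (extR ρ) v)
  embNf-ren ρ (nne e)  = embNe-ren ρ e

HasNf : ∀ {Γ σ} → Tm Γ σ → Set
HasNf {Γ} {σ} t = Σ (Nf Γ σ) λ v → Γ ⊢ t ≐ embNf v

Red : ∀ Γ σ → Tm Γ σ → Set
Red Γ N       t = HasNf t
Red Γ (σ ⇒ τ) t = ∀ {Δ} (ρ : Ren Γ Δ) {u : Tm Δ σ} → Red Δ σ u → Red Δ τ (app (ren ρ t) u)

Red-≐ : ∀ {Γ} σ {t t' : Tm Γ σ} → Γ ⊢ t ≐ t' → Red Γ σ t' → Red Γ σ t
Red-≐ N       d (v , d') = v , ≐-trans d d'
Red-≐ (σ ⇒ τ) d r ρ ru   = Red-≐ τ (≐-app (≐-ren ρ d) ≐-refl) (r ρ ru)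

Red-ren : ∀ {Γ Δ} σ (ρ : Ren Γ Δ) {t : Tm Γ σ} → Red Γ σ t → Red Δ σ (ren ρ t)
Red-ren N       ρ (v , d)        = renNf ρ v , subst (_ ⊢ _ ≐_) (sym (embNf-ren ρ v)) (≐-ren ρ d)
Red-ren (σ ⇒ τ) ρ {t} r ρ' {u} ru =
  subst (λ z → Red _ τ (app z u)) (sym (ren-∘ ρ ρ' t)) (r (λ x → ρ' (ρ x)) ru)

mutual
  reflect : ∀ {Γ} σ {t : Tm Γ σ} (e : Ne Γ σ) → Γ ⊢ t ≐ embNe e → Red Γ σ t
  reflect N       e d = nne e , d
  reflect (σ ⇒ τ) {t} e d ρ ru with reify σ ru
  ... | w , du = reflect τ (napp (renNe ρ e) w)
                   (≐-app (subst (_ ⊢ ren ρ t ≐_) (sym (embNe-ren ρ e)) (≐-ren ρ d)) du)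

  reify : ∀ {Γ} σ {t : Tm Γ σ} → Red Γ σ t → HasNf t
  reify N       r = r
  reify (σ ⇒ τ) {t} r with reify τ (r there (reflect σ (nvar here) ≐-refl))
  ... | v , d = nlam v , ≐-trans (≐-sym (≐-η t)) (≐-lam d)

Red-sub : ∀ {Γ Δ σ} {t : Tm Γ σ} → Pure t → (s : Sub Γ Δ) →
          (∀ {ρ} (x : Γ ∋ ρ) → Red Δ ρ (s x)) → Red Δ σ (sub s t)
Red-sub (var x) s rs = rs x
Red-sub {σ = τ} (app {t = t} {u = u} p q) s rs =
  subst (λ z → Red _ τ (app z (sub s u))) (ren-id (sub s t)) (Red-sub p s rs (λ x → x) (Red-sub q s rs))
Red-sub {σ = σ ⇒ τ} (lam {t = t} p) s rs ρ {u} ru =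
  Red-≐ τ (≐-β _ u) (subst (Red _ τ) (sym β-instance) (Red-sub p s' rs'))
  where
  s' : Sub (σ ∷ _) _
  s' here      = u
  s' (there x) = ren ρ (s x)
  rs' : ∀ {ρ'} (x : _ ∋ ρ') → Red _ ρ' (s' x)
  rs' here      = ru
  rs' (there x) = Red-ren _ ρ (rs x)
  β-instance : ren (extR ρ) (sub (extS s) t) [ u ] ≡ sub s' t
  β-instance = trans (sub-ren (extR ρ) (single u) (sub (extS s) t))
               (trans (sub-∘ (extS s) _ t)
               (sub-cong (λ { here → refl
                            ; (there x) → trans (sub-ren there _ (s x)) (sub-var ρ (s x)) }) t))

normalise : ∀ {Γ σ} {t : Tm Γ σ} → Pure t → HasNf t
normalise {σ = σ} {t} p =
  reify σ (subst (Red _ σ) (sub-id t) (Red-sub p var (λ x → reflect _ (nvar x) ≐-refl)))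

-- The set-theoretic model, with extensional equality as a partial equivalence

⟦_⟧ : Ty → Set
⟦ N ⟧     = ℕ
⟦ σ ⇒ τ ⟧ = ⟦ σ ⟧ → ⟦ τ ⟧

recℕ : ∀ {A : Set} → A → (A → ℕ → A) → ℕ → A
recℕ a b zero    = a
recℕ a b (suc n) = b (recℕ a b n) n

Env : Ctx → Set
Env Γ = ∀ {σ} → Γ ∋ σ → ⟦ σ ⟧

∅ : Env []
∅ ()

_▸_ : ∀ {Γ σ} → Env Γ → ⟦ σ ⟧ → Env (σ ∷ Γ)
(η ▸ a) here      = a
(η ▸ a) (there x) = η x

ev : ∀ {Γ σ} → Tm Γ σ → Env Γ → ⟦ σ ⟧
ev (var x)   η = η x
ev (lam t)   η = λ a → ev t (η ▸ a)
ev (app t u) η = ev t η (ev u η)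
ev zer       η = zero
ev suc       η = suc
ev (rec τ)   η = recℕ

Eq : ∀ σ → ⟦ σ ⟧ → ⟦ σ ⟧ → Set
Eq N       m n = m ≡ n
Eq (σ ⇒ τ) f g = ∀ a b → Eq σ a b → Eq τ (f a) (g b)

mutual
  Eq-sym : ∀ σ {a b} → Eq σ a b → Eq σ b a
  Eq-sym N       e       = sym e
  Eq-sym (σ ⇒ τ) e a b r = Eq-sym τ (e b a (Eq-sym σ r))

  Eq-trans : ∀ σ {a b c} → Eq σ a b → Eq σ b c → Eq σ a c
  Eq-trans N       e e'       = trans e e'
  Eq-trans (σ ⇒ τ) e e' a b r = Eq-trans τ (e a b r) (e' b b (Eq-trans σ (Eq-sym σ r) r))

Eq-reflˡ : ∀ σ {a b} → Eq σ a b → Eq σ a a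
Eq-reflˡ σ r = Eq-trans σ r (Eq-sym σ r)

EqEnv : ∀ {Γ} → Env Γ → Env Γ → Set
EqEnv {Γ} η η' = ∀ {σ} (x : Γ ∋ σ) → Eq σ (η x) (η' x)

EqEnv-▸ : ∀ {Γ σ} {η η' : Env Γ} {a b} → EqEnv η η' → Eq σ a b → EqEnv (η ▸ a) (η' ▸ b)
EqEnv-▸ e r here      = r
EqEnv-▸ e r (there x) = e x

recℕ-Eq : ∀ τ {a a' b b'} → Eq τ a a' → Eq (τ ⇒ N ⇒ τ) b b' → ∀ n → Eq τ (recℕ a b n) (recℕ a' b' n)
recℕ-Eq τ ra rb zero    = ra
recℕ-Eq τ ra rb (suc n) = rb _ _ (recℕ-Eq τ ra rb n) n n refl

ev-ren : ∀ {Γ Δ σ} (ρ : Ren Γ Δ) (t : Tm Γ σ) {η : Env Γ} {η' : Env Δ} →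
         (∀ {σ} (x : Γ ∋ σ) → Eq σ (η x) (η' (ρ x))) → Eq σ (ev t η) (ev (ren ρ t) η')
ev-ren ρ (var x)   e                         = e x
ev-ren ρ (lam t)   e a b r                   = ev-ren (extR ρ) t (λ { here → r ; (there x) → e x })
ev-ren ρ (app t u) e                         = ev-ren ρ t e _ _ (ev-ren ρ u e)
ev-ren ρ zer       e                         = refl
ev-ren ρ suc       e m n r                   = cong suc r
ev-ren ρ (rec τ)   e a a' ra b b' rb m n refl = recℕ-Eq τ ra rb m

ev-cong : ∀ {Γ σ} (t : Tm Γ σ) {η η' : Env Γ} → EqEnv η η' → Eq σ (ev t η) (ev t η')
ev-cong {σ = σ} t {η' = η'} e = subst (λ u → Eq σ (ev t _) (ev u η')) (ren-id t) (ev-ren (λ x → x) t e)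

ev-sub : ∀ {Γ Δ σ} (s : Sub Γ Δ) (t : Tm Γ σ) {η : Env Γ} {η' : Env Δ} → EqEnv η' η' →
         (∀ {σ} (x : Γ ∋ σ) → Eq σ (η x) (ev (s x) η')) → Eq σ (ev t η) (ev (sub s t) η')
ev-sub s (var x)   h e                         = e x
ev-sub s (lam t)   h e a b r                   =
  ev-sub (extS s) t (EqEnv-▸ h (Eq-reflˡ _ (Eq-sym _ r)))
    (λ { here → r ; (there x) → Eq-trans _ (e x) (ev-ren there (s x) h) })
ev-sub s (app t u) h e                         = ev-sub s t h e _ _ (ev-sub s u h e)
ev-sub s zer       h e                         = refl
ev-sub s suc       h e m n r                   = cong suc r
ev-sub s (rec τ)   h e a a' ra b b' rb m n refl = recℕ-Eq τ ra rb m

ev-sound : ∀ {Γ σ} {t u : Tm Γ σ} → Γ ⊢ t ≐ u → {η η' : Env Γ} → EqEnv η η' → Eq σ (ev t η) (ev u η')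
ev-sound {t = t} ≐-refl       e = ev-cong t e
ev-sound (≐-sym d)            e = Eq-sym _ (ev-sound d (λ x → Eq-sym _ (e x)))
ev-sound (≐-trans d d')       e = Eq-trans _ (ev-sound d (λ x → Eq-reflˡ _ (e x))) (ev-sound d' e)
ev-sound (≐-app d d')         e = ev-sound d e _ _ (ev-sound d' e)
ev-sound (≐-lam d)            e a b r = ev-sound d (EqEnv-▸ e r)
ev-sound (≐-β t u)            e = ev-sub (single u) t (λ x → Eq-reflˡ _ (Eq-sym _ (e x)))
                                    (λ { here → ev-cong u e ; (there x) → e x })
ev-sound (≐-η t) {η} {η'}     e a b r =
  Eq-sym _ (ev-ren there t {η'} {η ▸ a} (λ x → Eq-sym _ (e x)) b a (Eq-sym _ r))
ev-sound (≐-R0 A B)           e = ev-cong A e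
ev-sound (≐-RS A B C)         e = ev-cong (app (app B (app (app (app (rec _) A) B) C)) C) e

-- Cantor pairing, in ℕ and in T

tri : ℕ → ℕ
tri zero    = zero
tri (suc n) = tri n + suc n

tri-mono-≤ : ∀ {m n} → m ≤ n → tri m ≤ tri n
tri-mono-≤ {zero}            _         = z≤n
tri-mono-≤ {suc m} {suc n}   (s≤s m≤n) = +-mono-≤ (tri-mono-≤ m≤n) (s≤s m≤n)

pair : ℕ → ℕ → ℕ
pair a b = tri (a + b) + b

tri+≤<tri+ : ∀ {s s'} b b' → s < s' → b ≤ s → tri s + b < tri s' + b'
tri+≤<tri+ {s} {s'} b b' s<s' b≤s = begin-strict
  tri s + b      ≤⟨ +-monoʳ-≤ (tri s) b≤s ⟩
  tri s + s      <⟨ +-monoʳ-< (tri s) (n<1+n s) ⟩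
  tri (suc s)    ≤⟨ tri-mono-≤ s<s' ⟩
  tri s'         ≤⟨ m≤m+n (tri s') b' ⟩
  tri s' + b'    ∎
  where open ≤-Reasoning

pair-injective : ∀ {a b a' b'} → pair a b ≡ pair a' b' → a ≡ a' × b ≡ b'
pair-injective {a} {b} {a'} {b'} eq with <-cmp (a + b) (a' + b')
... | tri< lt _ _ = ⊥-elim (<-irrefl eq (tri+≤<tri+ b b' lt (m≤n+m b a)))
... | tri> _ _ gt = ⊥-elim (<-irrefl (sym eq) (tri+≤<tri+ b' b gt (m≤n+m b' a')))
... | tri≈ _ s≡s' _ = a≡a' , b≡b'
  where
  b≡b' : b ≡ b'
  b≡b' = +-cancelˡ-≡ (tri (a + b)) b b' (trans eq (cong (λ s → tri s + b') (sym s≡s')))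
  a≡a' : a ≡ a'
  a≡a' = +-cancelʳ-≡ b a a' (trans s≡s' (cong (a' +_) (sym b≡b')))

pair-≥ˡ : ∀ a b → a ≤ pair a b
pair-≥ˡ a b = ≤-trans (m≤m+n a b) (≤-trans (n≤tri (a + b)) (m≤m+n (tri (a + b)) b))
  where
  n≤tri : ∀ n → n ≤ tri n
  n≤tri zero    = z≤n
  n≤tri (suc n) = m≤n+m (suc n) (tri n)

pair-≥ʳ : ∀ a b → b ≤ pair a b
pair-≥ʳ a b = m≤n+m b (tri (a + b))

infixl 9 _·_
_·_ : ∀ {Γ σ τ} → Tm Γ (σ ⇒ τ) → Tm Γ σ → Tm Γ τ
_·_ = app

v0 : ∀ {Γ σ} → Tm (σ ∷ Γ) σ
v0 = var here

v1 : ∀ {Γ σ τ} → Tm (τ ∷ σ ∷ Γ) σ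
v1 = var (there here)

addT : ∀ {Γ} → Tm Γ (N ⇒ N ⇒ N)
addT = lam (lam (rec N · v1 · lam (lam (suc · v1)) · v0))

addT-ev : ∀ {Γ} (η : Env Γ) m n → ev addT η m n ≡ m + n
addT-ev η m zero    = sym (+-identityʳ m)
addT-ev η m (suc n) = trans (cong suc (addT-ev η m n)) (sym (+-suc m n))

triT : ∀ {Γ} → Tm Γ (N ⇒ N)
triT = lam (rec N · zer · lam (lam (addT · v1 · (suc · v0))) · v0)

triT-ev : ∀ {Γ} (η : Env Γ) n → ev triT η n ≡ tri n
triT-ev η zero    = refl
triT-ev η (suc n) = trans (addT-ev η _ (suc n)) (cong (_+ suc n) (triT-ev η n))

pairT : ∀ {Γ} → Tm Γ (N ⇒ N ⇒ N)
pairT = lam (lam (addT · (triT · (addT · v1 · v0)) · v0))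

pairT-ev : ∀ {Γ} (η : Env Γ) a b → ev pairT η a b ≡ pair a b
pairT-ev η a b = begin
  ev pairT η a b                              ≡⟨ addT-ev η _ b ⟩
  ev triT η (ev addT η a b) + b               ≡⟨ cong (λ s → ev triT η s + b) (addT-ev η a b) ⟩
  ev triT η (a + b) + b                       ≡⟨ cong (_+ b) (triT-ev η (a + b)) ⟩
  pair a b                                    ∎
  where open ≡-Reasoning

-- Reification into codes, in the model and in T

cvar : ℕ → ℕ
cvar n = pair 0 n

capp : ℕ → ℕ → ℕ
capp a b = pair 1 (pair a b)

clam : ℕ → ℕ → ℕ
clam n c = pair 2 (pair n c)

cvarT : ∀ {Γ} → Tm Γ (N ⇒ N)
cvarT = lam (pairT · zer · v0)

cappT : ∀ {Γ} → Tm Γ (N ⇒ N ⇒ N)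
cappT = lam (lam (pairT · (suc · zer) · (pairT · v1 · v0)))

clamT : ∀ {Γ} → Tm Γ (N ⇒ N ⇒ N)
clamT = lam (lam (pairT · (suc · (suc · zer)) · (pairT · v1 · v0)))

cvarT-ev : ∀ {Γ} (η : Env Γ) n → ev cvarT η n ≡ cvar n
cvarT-ev η n = pairT-ev η 0 n

cappT-ev : ∀ {Γ} (η : Env Γ) a b → ev cappT η a b ≡ capp a b
cappT-ev η a b = trans (pairT-ev η 1 (ev pairT η a b)) (cong (pair 1) (pairT-ev η a b))

clamT-ev : ∀ {Γ} (η : Env Γ) n c → ev clamT η n c ≡ clam n c
clamT-ev η n c = trans (pairT-ev η 2 (ev pairT η n c)) (cong (pair 2) (pairT-ev η n c))

-- The bound variable is named one more than the code obtained by naming it 0;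
-- as codes bound the names in them, this name is fresh for the body.
mutual
  reifyᴹ : ∀ σ → ⟦ σ ⟧ → ℕ
  reifyᴹ N       n = n
  reifyᴹ (σ ⇒ τ) f = clam x (reifyᴹ τ (f (reflectᴹ σ (cvar x))))
    where x = suc (reifyᴹ τ (f (reflectᴹ σ (cvar 0))))

  reflectᴹ : ∀ σ → ℕ → ⟦ σ ⟧
  reflectᴹ N       n   = n
  reflectᴹ (σ ⇒ τ) n a = reflectᴹ τ (capp n (reifyᴹ σ a))

mutual
  reifyᵀ : ∀ {Γ} σ → Tm Γ (σ ⇒ N)
  reifyᵀ N       = lam v0
  reifyᵀ (σ ⇒ τ) = lam (clamT · x · (reifyᵀ τ · (v0 · (reflectᵀ σ · (cvarT · x)))))
    where x = suc · (reifyᵀ τ · (v0 · (reflectᵀ σ · (cvarT · zer))))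

  reflectᵀ : ∀ {Γ} σ → Tm Γ (N ⇒ σ)
  reflectᵀ N       = lam v0
  reflectᵀ (σ ⇒ τ) = lam (lam (reflectᵀ τ · (cappT · v1 · (reifyᵀ σ · v0))))

mutual
  reifyᵀ-ev : ∀ σ {Γ} (η : Env Γ) {a b} → Eq σ a b → ev (reifyᵀ σ) η a ≡ reifyᴹ σ b
  reifyᵀ-ev N       η a≡b = a≡b
  reifyᵀ-ev (σ ⇒ τ) η {f} {g} f~g =
    trans (clamT-ev η' x (ev (reifyᵀ τ) η' (f a₁))) (cong₂ clam x≡ (reifyᵀ-ev τ η' (f~g a₁ _ a₁~)))
    where
    η' = η ▸ f
    a₀ = ev (reflectᵀ σ) η' (ev cvarT η' 0)
    x  = suc (ev (reifyᵀ τ) η' (f a₀))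
    a₁ = ev (reflectᵀ σ) η' (ev cvarT η' x)
    x≡ : x ≡ suc (reifyᴹ τ (g (reflectᴹ σ (cvar 0))))
    x≡ = cong suc (reifyᵀ-ev τ η' (f~g a₀ _ (reflectᵀ-ev σ η' (cvarT-ev η' 0))))
    a₁~ : Eq σ a₁ (reflectᴹ σ (cvar (suc (reifyᴹ τ (g (reflectᴹ σ (cvar 0)))))))
    a₁~ = reflectᵀ-ev σ η' (trans (cvarT-ev η' x) (cong cvar x≡))

  reflectᵀ-ev : ∀ σ {Γ} (η : Env Γ) {m n} → m ≡ n → Eq σ (ev (reflectᵀ σ) η m) (reflectᴹ σ n)
  reflectᵀ-ev N       η m≡n           = m≡n
  reflectᵀ-ev (σ ⇒ τ) η {m} m≡n a b a~b =
    reflectᵀ-ev τ η' (trans (cappT-ev η' m (ev (reifyᵀ σ) η' a)) (cong₂ capp m≡n (reifyᵀ-ev σ η' a~b)))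
    where η' = (η ▸ m) ▸ a

-- Normal forms are determined by their codes

data Tree : Set where
  tvar : ℕ → Tree
  tapp : Tree → Tree → Tree
  tlam : ℕ → Tree → Tree

tag : Tree → ℕ
tag (tvar _)   = 0
tag (tapp _ _) = 1
tag (tlam _ _) = 2

mutual
  encode : Tree → ℕ
  encode T = pair (tag T) (payload T)

  payload : Tree → ℕ
  payload (tvar n)   = n
  payload (tapp a b) = pair (encode a) (encode b)
  payload (tlam n c) = pair n (encode c)

mutual
  encode-injective : ∀ {T T'} → encode T ≡ encode T' → T ≡ T'
  encode-injective {T} {T'} e = tag-payload-injective T T' (pair-injective e)

  tag-payload-injective : ∀ T T' → tag T ≡ tag T' × payload T ≡ payload T' → T ≡ T'
  tag-payload-injective (tvar _)   (tvar _)     (_ , e) = cong tvar e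
  tag-payload-injective (tapp a b) (tapp a' b') (_ , e) with pair-injective e
  ... | ea , eb = cong₂ tapp (encode-injective ea) (encode-injective eb)
  tag-payload-injective (tlam _ c) (tlam _ c') (_ , e) with pair-injective e
  ... | en , ec = cong₂ tlam en (encode-injective ec)
  tag-payload-injective (tvar _)   (tapp _ _)   (() , _)
  tag-payload-injective (tvar _)   (tlam _ _)   (() , _)
  tag-payload-injective (tapp _ _) (tvar _)     (() , _)
  tag-payload-injective (tapp _ _) (tlam _ _)   (() , _)
  tag-payload-injective (tlam _ _) (tvar _)     (() , _)
  tag-payload-injective (tlam _ _) (tapp _ _)   (() , _)

payload≤encode : ∀ T → payload T ≤ encode T
payload≤encode T = pair-≥ʳ (tag T) (payload T)

Naming : Ctx → Set
Naming Γ = ∀ {σ} → Γ ∋ σ → ℕ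

_,ₙ_ : ∀ {Γ σ} → Naming Γ → ℕ → Naming (σ ∷ Γ)
(ν ,ₙ n) here      = n
(ν ,ₙ n) (there x) = ν x

-- The name of a bound variable is chosen exactly as in reifyᴹ.
mutual
  treeNe : ∀ {Γ σ} → Naming Γ → Ne Γ σ → Tree
  treeNe ν (nvar x)   = tvar (ν x)
  treeNe ν (napp e v) = tapp (treeNe ν e) (treeNf ν v)

  treeNf : ∀ {Γ σ} → Naming Γ → Nf Γ σ → Tree
  treeNf ν (nne e)  = treeNe ν e
  treeNf ν (nlam v) = tlam (freshName ν v) (treeNf (ν ,ₙ freshName ν v) v)

  freshName : ∀ {Γ σ τ} → Naming Γ → Nf (σ ∷ Γ) τ → ℕ
  freshName ν v = suc (encode (treeNf (ν ,ₙ 0) v))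

Generic : ∀ {Γ} → Naming Γ → Env Γ → Set
Generic {Γ} ν η = ∀ {σ} (x : Γ ∋ σ) → η x ≡ reflectᴹ σ (cvar (ν x))

Generic-▸ : ∀ {Γ σ} {ν : Naming Γ} {η : Env Γ} n →
            Generic ν η → Generic (ν ,ₙ n) (η ▸ reflectᴹ σ (cvar n))
Generic-▸ n g here      = refl
Generic-▸ n g (there x) = g x

mutual
  ev-treeNe : ∀ {Γ σ} (e : Ne Γ σ) {ν : Naming Γ} {η : Env Γ} → Generic ν η →
              ev (embNe e) η ≡ reflectᴹ σ (encode (treeNe ν e))
  ev-treeNe (nvar x)   g = g x
  ev-treeNe {σ = τ} (napp e v) {ν} {η} g = begin
    ev (embNe e) η (ev (embNf v) η)
      ≡⟨ cong-app (ev-treeNe e g) (ev (embNf v) η) ⟩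
    reflectᴹ τ (capp (encode (treeNe ν e)) (reifyᴹ _ (ev (embNf v) η)))
      ≡⟨ cong (reflectᴹ τ ∘ capp (encode (treeNe ν e))) (reifyᴹ-treeNf v g) ⟩
    reflectᴹ τ (capp (encode (treeNe ν e)) (encode (treeNf ν v)))
      ∎
    where open ≡-Reasoning

  reifyᴹ-treeNf : ∀ {Γ σ} (v : Nf Γ σ) {ν : Naming Γ} {η : Env Γ} → Generic ν η →
                  reifyᴹ σ (ev (embNf v) η) ≡ encode (treeNf ν v)
  reifyᴹ-treeNf (nne e) g = ev-treeNe e g
  reifyᴹ-treeNf {σ = σ ⇒ τ} (nlam v) {ν} {η} g = cong₂ clam x≡ (trans
    (cong (λ n → reifyᴹ τ (ev (embNf v) (η ▸ reflectᴹ σ (cvar n)))) x≡)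
    (reifyᴹ-treeNf v (Generic-▸ _ g)))
    where
    x≡ : suc (reifyᴹ τ (ev (embNf v) (η ▸ reflectᴹ σ (cvar 0)))) ≡ freshName ν v
    x≡ = cong suc (reifyᴹ-treeNf v (Generic-▸ 0 g))

infix 4 _∈Ne_ _∈Nf_
mutual
  data _∈Ne_ {Γ σ} (x : Γ ∋ σ) : ∀ {τ} → Ne Γ τ → Set where
    var∈  : x ∈Ne nvar x
    appˡ∈ : ∀ {τ τ'} {e : Ne Γ (τ ⇒ τ')} {v} → x ∈Ne e → x ∈Ne napp e v
    appʳ∈ : ∀ {τ τ'} {e : Ne Γ (τ ⇒ τ')} {v} → x ∈Nf v → x ∈Ne napp e v

  data _∈Nf_ {Γ σ} (x : Γ ∋ σ) : ∀ {τ} → Nf Γ τ → Set where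
    lam∈ : ∀ {τ τ'} {v : Nf (τ ∷ Γ) τ'} → there x ∈Nf v → x ∈Nf nlam v
    ne∈  : ∀ {e} → x ∈Ne e → x ∈Nf nne e

mutual
  name≤encodeNe : ∀ {Γ σ τ} {x : Γ ∋ σ} {e : Ne Γ τ} (ν : Naming Γ) →
                  x ∈Ne e → ν x ≤ encode (treeNe ν e)
  name≤encodeNe ν var∈ = pair-≥ʳ 0 _
  name≤encodeNe ν (appˡ∈ {e = e} {v} o) =
    ≤-trans (name≤encodeNe ν o) (≤-trans (pair-≥ˡ _ _) (payload≤encode (tapp (treeNe ν e) (treeNf ν v))))
  name≤encodeNe ν (appʳ∈ {e = e} {v} o) =
    ≤-trans (name≤encodeNf ν o) (≤-trans (pair-≥ʳ (encode (treeNe ν e)) _) (payload≤encode (tapp (treeNe ν e) (treeNf ν v))))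

  name≤encodeNf : ∀ {Γ σ τ} {x : Γ ∋ σ} {v : Nf Γ τ} (ν : Naming Γ) →
                  x ∈Nf v → ν x ≤ encode (treeNf ν v)
  name≤encodeNf ν (lam∈ {v = v} o) =
    ≤-trans (name≤encodeNf (ν ,ₙ x) o) (≤-trans (pair-≥ʳ x _) (payload≤encode (tlam x (treeNf (ν ,ₙ x) v))))
    where x = freshName ν v
  name≤encodeNf ν (ne∈ o)  = name≤encodeNe ν o

Names : Ctx → Set
Names Γ = ℕ → Maybe (Σ Ty (Γ ∋_))

bind : ∀ {Γ σ} → Names Γ → ℕ → Names (σ ∷ Γ)
bind {σ = σ} ρ n m with m ≟ n
... | yes _ = just (σ , here)
... | no _  = Maybe.map (λ (τ , x) → τ , there x) (ρ m)

bind-≡ : ∀ {Γ σ} (ρ : Names Γ) n → bind {σ = σ} ρ n n ≡ just (σ , here)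
bind-≡ ρ n with n ≟ n
... | yes _  = refl
... | no n≢n = ⊥-elim (n≢n refl)

bind-≢ : ∀ {Γ σ τ} (ρ : Names Γ) {n m} {x : Γ ∋ τ} → m ≢ n → ρ m ≡ just (τ , x) →
         bind {σ = σ} ρ n m ≡ just (τ , there x)
bind-≢ ρ {n} {m} m≢n ρm≡x with m ≟ n
... | yes m≡n = ⊥-elim (m≢n m≡n)
... | no _ rewrite ρm≡x = refl

napp? : ∀ {Γ} → Maybe (Σ Ty (Ne Γ)) → (∀ σ → Maybe (Nf Γ σ)) → Maybe (Σ Ty (Ne Γ))
napp? (just ((σ ⇒ τ) , e)) arg = Maybe.map (λ v → τ , napp e v) (arg σ)
napp? _                    arg = nothing

nne? : ∀ {Γ} → Maybe (Σ Ty (Ne Γ)) → Maybe (Nf Γ N)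
nne? (just (N , e)) = just (nne e)
nne? _              = nothing

mutual
  decodeNe : ∀ {Γ} → Names Γ → Tree → Maybe (Σ Ty (Ne Γ))
  decodeNe ρ (tvar n)   = Maybe.map (λ (σ , x) → σ , nvar x) (ρ n)
  decodeNe ρ (tapp a b) = napp? (decodeNe ρ a) (λ σ → decodeNf ρ σ b)
  decodeNe ρ (tlam _ _) = nothing

  decodeNf : ∀ {Γ} → Names Γ → ∀ σ → Tree → Maybe (Nf Γ σ)
  decodeNf ρ N       T          = nne? (decodeNe ρ T)
  decodeNf ρ (σ ⇒ τ) (tlam n c) = Maybe.map nlam (decodeNf (bind ρ n) τ c)
  decodeNf ρ (σ ⇒ τ) _          = nothing

mutual
  decode-treeNe : ∀ {Γ σ} (e : Ne Γ σ) {ν : Naming Γ} {ρ : Names Γ} →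
                  (∀ {τ} (x : Γ ∋ τ) → x ∈Ne e → ρ (ν x) ≡ just (τ , x)) →
                  decodeNe ρ (treeNe ν e) ≡ just (σ , e)
  decode-treeNe (nvar x)   h rewrite h x var∈ = refl
  decode-treeNe (napp e v) {ν} {ρ} h
    rewrite decode-treeNe e {ν} {ρ} (λ x o → h x (appˡ∈ o))
          | decode-treeNf v {ν} {ρ} (λ x o → h x (appʳ∈ o)) = refl

  decode-treeNf : ∀ {Γ σ} (v : Nf Γ σ) {ν : Naming Γ} {ρ : Names Γ} →
                  (∀ {τ} (x : Γ ∋ τ) → x ∈Nf v → ρ (ν x) ≡ just (τ , x)) →
                  decodeNf ρ σ (treeNf ν v) ≡ just v
  decode-treeNf (nne e) {ν} {ρ} h rewrite decode-treeNe e {ν} {ρ} (λ x o → h x (ne∈ o)) = refl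
  decode-treeNf (nlam v) {ν} {ρ} h = cong (Maybe.map nlam) (decode-treeNf v h')
    where
    x = freshName ν v
    h' : ∀ {τ} (y : _ ∋ τ) → y ∈Nf v → bind ρ x ((ν ,ₙ x) y) ≡ just (τ , y)
    h' here      _ = bind-≡ ρ x
    h' (there y) o = bind-≢ ρ (<⇒≢ (s≤s (name≤encodeNf (ν ,ₙ 0) o))) (h y (lam∈ o))

treeNf-injective : ∀ {σ} {v w : Nf [] σ} → treeNf (λ ()) v ≡ treeNf (λ ()) w → v ≡ w
treeNf-injective {σ} {v} {w} eq = just-injective (begin
  just v                            ≡⟨ decode-treeNf v (λ ()) ⟨
  decodeNf (λ _ → nothing) σ (treeNf (λ ()) v) ≡⟨ cong (decodeNf (λ _ → nothing) σ) eq ⟩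
  decodeNf (λ _ → nothing) σ (treeNf (λ ()) w) ≡⟨ decode-treeNf w (λ ()) ⟩
  just w                            ∎)
  where open ≡-Reasoning

ev-reifyᵀ-nf : ∀ {σ} (A : Closed σ) (v : Nf [] σ) → T⊢ A ≐ embNf v →
               ev (reifyᵀ σ · A) ∅ ≡ encode (treeNf (λ ()) v)
ev-reifyᵀ-nf {σ} A v A≐v = trans (reifyᵀ-ev σ ∅ (ev-sound A≐v {∅} {∅} (λ ()))) (reifyᴹ-treeNf v (λ ()))

theorem5 : (τ : Ty) → Σ (Closed (τ ⇒ N)) λ Nτ →
    (A B : Closed τ) → Pure A → Pure B →
    (T⊢ app Nτ A ≐ app Nτ B) ⇔ (T⊢ A ≐ B)
theorem5 τ = reifyᵀ τ , λ A B pA pB → mk⇔ (injective pA pB) (≐-app ≐-refl)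
  where
  injective : ∀ {A B} → Pure A → Pure B → T⊢ reifyᵀ τ · A ≐ reifyᵀ τ · B → T⊢ A ≐ B
  injective {A} {B} pA pB d with normalise pA | normalise pB
  ... | v , A≐v | w , B≐w = ≐-trans A≐v (subst (λ u → T⊢ embNf u ≐ B) (sym v≡w) (≐-sym B≐w))
    where
    open ≡-Reasoning
    v≡w : v ≡ w
    v≡w = treeNf-injective (encode-injective (begin
      encode (treeNf (λ ()) v)  ≡⟨ ev-reifyᵀ-nf A v A≐v ⟨
      ev (reifyᵀ τ · A) ∅       ≡⟨ ev-sound d (λ ()) ⟩
      ev (reifyᵀ τ · B) ∅       ≡⟨ ev-reifyᵀ-nf B w B≐w ⟩
      encode (treeNf (λ ()) w)  ∎))
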